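{- For the triangle game on the triangular grid with $n$ winning sets, $\mathrm{SC}_2(\mathcal G_{\triangle},1)\ge \frac{3n}{4}-o(n)$.
   Context: An $s$-of-$k$ game on a $k$-uniform hypergraph $(V,\mathcal F)$ (winning sets are $k$-element subsets of the finite set $V$), $1\le s\le k$: Maker and Breaker alternately claim unclaimed vertices, Maker first, until all are claimed; the score is the number of winning sets in which Maker claimed at least $s$ vertices (Maker maximizes, Breaker minimizes). A pairing strategy for Maker: she fixes in advance pairwise disjoint pairs of vertices and, whenever Breaker claims a vertex of a pair whose partner is unclaimed, she claims the partner (other moves arbitrary). $\mathrm{SC}_2(\mathcal H,s)$ is the largest score Maker can guarantee against every Breaker strategy using a pairing strategy. $\mathcal G_{\triangle}$ is the hypergraph whose vertices are the points of a finite portion of the triangular lattice (the plane tiled by unit equilateral triangles) and whose winning sets are the vertex sets of the unit triangular faces (both orientations), so $k=3$. Grids are assumed "two-dimensional": the number of winning sets within constant distance of the boundary is $o(n)$, where $n$ is the number of winning sets; $o(n)$ refers to $n\to\infty$. -}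

module Defs where

open import Data.Nat using (ℕ; zero; suc; _≤_; _≤?_)
open import Data.Integer as ℤ using (ℤ; +_; -[1+_])
open import Data.Fin using (Fin; zero; suc)
open import Data.List using (List; []; _∷_; length; filter; lookup; allFin; concatMap)
open import Data.Bool.ListAction using (all)
open import Data.Maybe using (Maybe; just; nothing)
import Data.Maybe as Maybe
open import Data.Bool using (Bool; true; false; _∧_; not; T)
open import Data.Product using (_×_; _,_; Σ; ∃)
import Data.Product.Properties as ×P
open import Data.Unit using (⊤)
open import Data.Empty using (⊥)
open import Relation.Nullary using (¬_; does)
open import Relation.Nullary.Decidable using (⌊_⌋)
open import Relation.Binary.PropositionalEquality using (_≡_; _≢_)
open import Data.List.Relation.Unary.Unique.Propositional using (Unique)

data Cell : Set where
  free maker breaker : Cell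

Board : ℕ → Set
Board N = Fin N → Cell

_[_≔_] : ∀ {N} → Board N → Fin N → Cell → Board N
(B [ i ≔ c ]) j with ⌊ i Data.Fin.≟ j ⌋
... | true  = c
... | false = B j

isMaker : Cell → Bool
isMaker maker = true
isMaker _     = false

makerCount : ∀ {N} → Board N → List (Fin N) → ℕ
makerCount B []      = zero
makerCount B (i ∷ S) with isMaker (B i)
... | true  = suc (makerCount B S)
... | false = makerCount B S

score : ∀ {N} → List (List (Fin N)) → ℕ → Board N → ℕ
score F s B = length (filter (λ S → s ≤? makerCount B S) F)

Finished : ∀ {N} → Board N → Set
Finished B = ∀ i → B i ≢ free

-- A pairing: partner i = just j means {i,j} is one of the pairs.
-- Pairs are disjoint 2-element sets (symmetric, no fixed points).
IsPairing : ∀ {N} → (Fin N → Maybe (Fin N)) → Set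
IsPairing {N} p = ∀ (i j : Fin N) → p i ≡ just j → (p j ≡ just i) × (i ≢ j)

-- Maker's move i respects the pairing rule given Breaker's last move:
-- if Breaker just claimed b whose partner j is still free, Maker must take j.
Respects : ∀ {N} → (Fin N → Maybe (Fin N)) → Board N → Maybe (Fin N) → Fin N → Set
Respects p B nothing  i = ⊤
Respects p B (just b) i with p b
... | nothing = ⊤
... | just j  = B j ≡ free → i ≡ j

-- MakerTurn p F s t B last : Maker, to move in position B (Breaker's last
-- move being 'last'), has a strategy obeying the pairing p that guarantees
-- a final score ≥ t against every Breaker strategy.
mutual
  data MakerTurn {N} (p : Fin N → Maybe (Fin N)) (F : List (List (Fin N)))
                 (s t : ℕ) : Board N → Maybe (Fin N) → Set where
    m-done : ∀ {B last} → Finished B → t ≤ score F s B → MakerTurn p F s t B last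
    m-move : ∀ {B last} (i : Fin N) → B i ≡ free → Respects p B last i →
             BreakerTurn p F s t (B [ i ≔ maker ]) → MakerTurn p F s t B last

  data BreakerTurn {N} (p : Fin N → Maybe (Fin N)) (F : List (List (Fin N)))
                   (s t : ℕ) : Board N → Set where
    b-done : ∀ {B} → Finished B → t ≤ score F s B → BreakerTurn p F s t B
    b-all  : ∀ {B} → (Σ (Fin N) λ i → B i ≡ free) →
             (∀ i → B i ≡ free → MakerTurn p F s t (B [ i ≔ breaker ]) (just i)) →
             BreakerTurn p F s t B

emptyBoard : ∀ {N} → Board N
emptyBoard _ = free

-- Maker can guarantee score ≥ t in the s-of-k game on (Fin N, F) with a
-- pairing strategy, i.e. SC₂(F, s) ≥ t.
PairingGuarantee : (N : ℕ) → List (List (Fin N)) → ℕ → ℕ → Set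
PairingGuarantee N F s t =
  Σ (Fin N → Maybe (Fin N)) λ p → IsPairing p × MakerTurn p F s t emptyBoard nothing

-- Triangular lattice.  Point (a , b) = a·e₁ + b·e₂ with e₁ = (1,0),
-- e₂ = (1/2, √3/2).  Up-triangles {(a,b),(a+1,b),(a,b+1)},
-- down-triangles {(a,b),(a-1,b+1),(a,b+1)}.

Point : Set
Point = ℤ × ℤ

_⊕_ : Point → Point → Point
(a , b) ⊕ (c , d) = (a ℤ.+ c , b ℤ.+ d)

_≟ᴾ_ : (p q : Point) → Relation.Nullary.Dec (p ≡ q)
_≟ᴾ_ = ×P.≡-dec ℤ._≟_ ℤ._≟_

record Portion : Set where
  field
    pts  : List Point
    uniq : Unique pts
open Portion public

indexOf : Point → (V : List Point) → Maybe (Fin (length V))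
indexOf p []      = nothing
indexOf p (q ∷ V) with ⌊ p ≟ᴾ q ⌋
... | true  = just zero
... | false = Maybe.map suc (indexOf p V)

memb : Point → List Point → Bool
memb p V with indexOf p V
... | just _  = true
... | nothing = false

e₁ e₂ e₂-e₁ : Point
e₁ = (+ 1 , + 0)
e₂ = (+ 0 , + 1)
e₂-e₁ = (-[1+ 0 ] , + 1)

triAt : (V : List Point) → Point → Fin (length V) → Point → Point → List (List (Fin (length V)))
triAt V p i u v with indexOf (p ⊕ u) V | indexOf (p ⊕ v) V
... | just j | just k = (i ∷ j ∷ k ∷ []) ∷ []
... | _      | _      = []

-- winning sets: all unit triangles (both orientations) with all three
-- vertices in V; each triangle is listed once (anchored at one vertex).
triangles : (V : List Point) → List (List (Fin (length V)))
triangles V = concatMap (λ i → let p = lookup V i in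
                 triAt V p i e₁ e₂ Data.List.++ triAt V p i e₂-e₁ e₂)
              (allFin (length V))

winSets : (G : Portion) → List (List (Fin (length (pts G))))
winSets G = triangles (pts G)

nWin : Portion → ℕ
nWin G = length (winSets G)

nbrs : List Point
nbrs = (+ 1 , + 0) ∷ (-[1+ 0 ] , + 0) ∷ (+ 0 , + 1) ∷ (+ 0 , -[1+ 0 ])
     ∷ (+ 1 , -[1+ 0 ]) ∷ (-[1+ 0 ] , + 1) ∷ []

deep : List Point → ℕ → Point → Bool
deep V zero    p = memb p V
deep V (suc d) p = deep V d p ∧ all (λ u → deep V d (p ⊕ u)) nbrs

-- number of winning sets within distance d of the boundary, i.e. having a
-- vertex within lattice distance d of a lattice point outside the portion
nearBoundary : ℕ → Portion → ℕ
nearBoundary d G =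
  length (filter (λ S → Relation.Nullary.Decidable.¬? (Data.Bool._≟_ (all (λ i → deep (pts G) d (lookup (pts G) i)) S) true))
                 (winSets G))

module Submission where

open import Defs
open import Data.Nat using (ℕ; zero; suc; _≤_; _<_; _+_; _*_; _∸_; z≤n; s≤s; _≤?_)
import Data.Nat.Properties as ℕ
open import Data.Nat.DivMod using (_/_; m*n/n≡m; m/n*n≤m; /-monoˡ-≤)
open import Data.Nat.Induction using (<-wellFounded)
open import Data.Nat.ListAction using (sum)
open import Data.Nat.ListAction.Properties using (sum-↭)
open import Data.Nat.Tactic.RingSolver using (solve-∀)
open import Data.Integer as ℤ using (ℤ; -[1+_])
import Data.Integer.Properties as ℤ
open import Data.Bool using (Bool; true; false; not; if_then_else_)
import Data.Bool as Bool
open import Data.Bool.Properties using (not-involutive; not-¬; ∧-conicalˡ; ∧-conicalʳ)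
open import Data.Bool.ListAction using (all)
open import Data.Fin using (Fin)
import Data.Fin as Fin
import Data.Fin.Properties as Fin
open import Data.List using (List; []; _∷_; _++_; length; lookup; map; filter; concatMap; allFin)
import Data.List.Properties as List
open import Data.List.Membership.Propositional using (_∈_; _∉_)
open import Data.List.Membership.Propositional.Properties
  using (∈-∃++; ∈-map⁻; ∈-filter⁻; ∈-++⁻; ∈-allFin; ∈-lookup)
open import Data.List.Membership.DecPropositional using () renaming (_∈?_ to member?)
open import Data.List.Relation.Unary.Any using (here; there)
import Data.List.Relation.Unary.All as All
open import Data.List.Relation.Unary.AllPairs using (_∷_)
open import Data.List.Relation.Unary.Unique.Propositional using (Unique)
import Data.List.Relation.Unary.Unique.Propositional.Properties as Unique
open import Data.List.Relation.Binary.Permutation.Propositional.Properties using (shift; ∈-resp-↭)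
import Data.List.Relation.Binary.Permutation.Propositional.Properties as ↭
open import Data.Maybe using (Maybe; just; nothing; maybe)
open import Data.Maybe.Properties using (just-injective)
open import Data.Product using (Σ; ∃; ∃₂; _×_; _,_; proj₁; proj₂)
open import Data.Sum using (_⊎_; inj₁; inj₂; [_,_]′)
open import Data.Unit using (tt)
open import Data.Empty using (⊥)
open import Function using (_∘_; _∘′_; id)
open import Level using (0ℓ)
open import Induction.WellFounded using (Acc; acc)
open import Relation.Nullary using (¬_; ¬?; Dec; yes; no; contradiction)
open import Relation.Nullary.Decidable using (toSum)
open import Relation.Unary using (Pred; Decidable)
open import Relation.Unary.Properties using (∁?)
open import Relation.Binary.Definitions using (DecidableEquality)
open import Relation.Binary.PropositionalEquality
open import Algebra.Properties.CommutativeSemigroup ℕ.+-commutativeSemigroup using (interchange)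

-- Maker pairs each lattice point (2c , b) with (2c + 1 , b) and answers Breaker inside the pair,
-- so Breaker never owns both points of a pair.  Every unit triangle is listed at an anchor vertex p
-- and is lost only if Breaker owns all its vertices.  Hence triangles anchored at p and at its mate
-- are never both lost, and by parity neither are the up- and the down-triangle anchored at p.  An
-- interior pair anchors four triangles, at most one of them lost; summing over the points (mate is
-- an involution, and only points near the boundary have their mate outside the portion) gives
-- 4 · lost ≤ n + 6 · (triangles near the boundary), so Maker scores at least 3n/4 − o(n).

-- Sums over lists

private variable
  A A′ : Set

∑ : List A → (A → ℕ) → ℕ
∑ xs f = sum (map f xs)

∑-cong : ∀ xs {f g : A → ℕ} → (∀ x → f x ≡ g x) → ∑ xs f ≡ ∑ xs g
∑-cong xs f≗g = cong sum (List.map-cong f≗g xs)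

∑-mono : ∀ xs {f g : A → ℕ} → (∀ {x} → x ∈ xs → f x ≤ g x) → ∑ xs f ≤ ∑ xs g
∑-mono []       f≤g = z≤n
∑-mono (x ∷ xs) f≤g = ℕ.+-mono-≤ (f≤g (here refl)) (∑-mono xs (f≤g ∘ there))

∑-mono-< : ∀ xs {f g : A → ℕ} → (∀ x → f x ≤ g x) → ∀ {x} → x ∈ xs → f x < g x → ∑ xs f < ∑ xs g
∑-mono-< (x ∷ xs) f≤g (here refl)  fx<gx = ℕ.+-mono-<-≤ fx<gx (∑-mono xs λ {y} _ → f≤g y)
∑-mono-< (y ∷ xs) f≤g (there x∈xs) fx<gx = ℕ.+-mono-≤-< (f≤g y) (∑-mono-< xs f≤g x∈xs fx<gx)

∑-+ : ∀ xs (f g : A → ℕ) → ∑ xs (λ x → f x + g x) ≡ ∑ xs f + ∑ xs g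
∑-+ []       f g = refl
∑-+ (x ∷ xs) f g = trans (cong (f x + g x +_) (∑-+ xs f g)) (interchange (f x) (g x) (∑ xs f) (∑ xs g))

∑-* : ∀ xs c (f : A → ℕ) → ∑ xs (λ x → c * f x) ≡ c * ∑ xs f
∑-* []       c f = sym (ℕ.*-zeroʳ c)
∑-* (x ∷ xs) c f = trans (cong (c * f x +_) (∑-* xs c f)) (sym (ℕ.*-distribˡ-+ c (f x) (∑ xs f)))

∑-map : ∀ (σ : A → A′) xs (f : A′ → ℕ) → ∑ (map σ xs) f ≡ ∑ xs (f ∘ σ)
∑-map σ xs f = cong sum (sym (List.map-∘ xs))

∑-shift : ∀ x ys zs (f : A → ℕ) → ∑ (ys ++ x ∷ zs) f ≡ f x + ∑ (ys ++ zs) f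
∑-shift x ys zs f = sum-↭ (↭.map⁺ f (shift x ys zs))

∑-concatMap : (k : List A′ → ℕ) → k [] ≡ 0 → (∀ xs ys → k (xs ++ ys) ≡ k xs + k ys) →
              (g : A → List A′) → ∀ xs → k (concatMap g xs) ≡ ∑ xs (k ∘ g)
∑-concatMap k k[] k++ g []       = k[]
∑-concatMap k k[] k++ g (x ∷ xs) = trans (k++ (g x) (concatMap g xs)) (cong (k (g x) +_) (∑-concatMap k k[] k++ g xs))

∑-support-≤ : ∀ {xs ys} (f : A → ℕ) → Unique xs → (∀ {x} → x ∈ xs → f x ≢ 0 → x ∈ ys) → ∑ xs f ≤ ∑ ys f
∑-support-≤ {xs = []}     f _                  support = z≤n
∑-support-≤ {xs = x ∷ xs} f (x∉xs ∷ xs-unique) support with f x ℕ.≟ 0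
... | yes fx≡0 = ℕ.≤-trans (ℕ.≤-reflexive (cong (_+ ∑ xs f) fx≡0)) (∑-support-≤ f xs-unique (support ∘ there))
... | no  fx≢0 with ∈-∃++ (support (here refl) fx≢0)
...   | us , vs , refl =
  ℕ.≤-trans (ℕ.+-monoʳ-≤ (f x) (∑-support-≤ f xs-unique support′)) (ℕ.≤-reflexive (sym (∑-shift x us vs f)))
  where
  support′ : ∀ {z} → z ∈ xs → f z ≢ 0 → z ∈ us ++ vs
  support′ z∈xs fz≢0 with ∈-resp-↭ (shift x us vs) (support (there z∈xs) fz≢0)
  ... | here z≡x   = contradiction (sym z≡x) (All.lookup x∉xs z∈xs)
  ... | there z∈uv = z∈uv

∑-∘-injective-≤ : ∀ {xs ys} {σ : A → A′} → (∀ {x y} → σ x ≡ σ y → x ≡ y) → (f : A′ → ℕ) → Unique xs →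
                  (∀ {x} → x ∈ xs → f (σ x) ≢ 0 → σ x ∈ ys) → ∑ xs (f ∘ σ) ≤ ∑ ys f
∑-∘-injective-≤ {xs = xs} {ys} {σ} σ-injective f xs-unique support =
  subst (_≤ ∑ ys f) (∑-map σ xs f) (∑-support-≤ f (Unique.map⁺ σ-injective xs-unique) support′)
  where
  support′ : ∀ {y} → y ∈ map σ xs → f y ≢ 0 → y ∈ ys
  support′ y∈σxs fy≢0 with ∈-map⁻ σ y∈σxs
  ... | x , x∈xs , refl = support x∈xs fy≢0

module _ {A : Set} (_≟_ : DecidableEquality A) {σ : A → A} (σ-involutive : ∀ x → σ (σ x) ≡ x) where

  private
    σ-injective : ∀ {x y} → σ x ≡ σ y → x ≡ y
    σ-injective {x} {y} σx≡σy = trans (sym (σ-involutive x)) (trans (cong σ σx≡σy) (σ-involutive y))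

  ∑-∘-involution-≤ : ∀ {xs} (f : A → ℕ) → Unique xs → (∀ {x} → f x ≢ 0 → x ∈ xs) → ∑ xs (f ∘ σ) ≤ ∑ xs f
  ∑-∘-involution-≤ f xs-unique support = ∑-∘-injective-≤ σ-injective f xs-unique (λ _ → support)

  -- The terms of ∑ xs f at points x whose image σ x stays in xs reappear in ∑ xs (f ∘ σ);
  -- the others are charged to r.
  ∑-≤-∑-∘-involution : ∀ {xs} (f r : A → ℕ) → Unique xs → (∀ {x} → x ∈ xs → σ x ∉ xs → f x ≤ r x) →
                       ∑ xs f ≤ ∑ xs (f ∘ σ) + ∑ xs r
  ∑-≤-∑-∘-involution {xs} f r xs-unique escape = begin
    ∑ xs f                      ≤⟨ ∑-mono xs split ⟩
    ∑ xs (λ x → g (σ x) + r x)  ≡⟨ ∑-+ xs (g ∘ σ) r ⟩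
    ∑ xs (g ∘ σ) + ∑ xs r       ≤⟨ ℕ.+-monoˡ-≤ (∑ xs r) (∑-∘-injective-≤ σ-injective g xs-unique λ _ → g-support) ⟩
    ∑ xs g + ∑ xs r             ≤⟨ ℕ.+-monoˡ-≤ (∑ xs r) (∑-mono xs λ {x} _ → g≤f∘σ x) ⟩
    ∑ xs (f ∘ σ) + ∑ xs r       ∎
    where
    open ℕ.≤-Reasoning

    g : A → ℕ
    g y with member? _≟_ y xs
    ... | yes _ = f (σ y)
    ... | no  _ = 0

    g-support : ∀ {y} → g y ≢ 0 → y ∈ xs
    g-support {y} gy≢0 with member? _≟_ y xs
    ... | yes y∈xs = y∈xs
    ... | no  _    = contradiction refl gy≢0

    g≤f∘σ : ∀ y → g y ≤ f (σ y)
    g≤f∘σ y with member? _≟_ y xs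
    ... | yes _ = ℕ.≤-refl
    ... | no  _ = z≤n

    split : ∀ {x} → x ∈ xs → f x ≤ g (σ x) + r x
    split {x} x∈xs with member? _≟_ (σ x) xs
    ... | yes _     = subst (λ z → f x ≤ f z + r x) (sym (σ-involutive x)) (ℕ.m≤m+n (f x) (r x))
    ... | no  σx∉xs = escape x∈xs σx∉xs

count : {P : Pred A 0ℓ} → Decidable P → List A → ℕ
count P? xs = length (filter P? xs)

module _ {P : Pred A 0ℓ} (P? : Decidable P) where

  count-++ : ∀ xs ys → count P? (xs ++ ys) ≡ count P? xs + count P? ys
  count-++ xs ys = trans (cong length (List.filter-++ P? xs ys)) (List.length-++ (filter P? xs))

  count-+-count-∁ : ∀ xs → count P? xs + count (∁? P?) xs ≡ length xs
  count-+-count-∁ []       = refl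
  count-+-count-∁ (x ∷ xs) with P? x
  ... | yes _ = cong suc (count-+-count-∁ xs)
  ... | no  _ = trans (ℕ.+-suc _ _) (cong suc (count-+-count-∁ xs))

  count>0⇒∃ : ∀ xs → 0 < count P? xs → ∃ λ x → x ∈ xs × P x
  count>0⇒∃ xs positive with filter P? xs in eq
  ... | []    = contradiction positive λ ()
  ... | x ∷ _ = x , ∈-filter⁻ P? (subst (x ∈_) (sym eq) (here refl))

-- Pairing strategies

free? : (c : Cell) → Dec (c ≡ free)
free? free    = yes refl
free? maker   = no λ ()
free? breaker = no λ ()

breaker-if-claimed : ∀ {c} → c ≢ free → c ≢ maker → c ≡ breaker
breaker-if-claimed {free}    c≢free _       = contradiction refl c≢free
breaker-if-claimed {maker}   _      c≢maker = contradiction refl c≢maker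
breaker-if-claimed {breaker} _      _       = refl

isFree : Cell → ℕ
isFree free    = 1
isFree maker   = 0
isFree breaker = 0

isFree-claimed : ∀ {c} → c ≢ free → isFree c ≡ 0
isFree-claimed {free}    c≢free = contradiction refl c≢free
isFree-claimed {maker}   _      = refl
isFree-claimed {breaker} _      = refl

module _ {N : ℕ} where

  private variable
    B : Board N
    b x y : Fin N

  update-same : ∀ (B : Board N) i c → (B [ i ≔ c ]) i ≡ c
  update-same B i c with i Fin.≟ i
  ... | yes _   = refl
  ... | no  i≢i = contradiction refl i≢i

  update-other : ∀ (B : Board N) {i j} c → i ≢ j → (B [ i ≔ c ]) j ≡ B j
  update-other B {i} {j} c i≢j with i Fin.≟ j
  ... | yes i≡j = contradiction i≡j i≢j
  ... | no  _   = refl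

  freeCount : Board N → ℕ
  freeCount B = ∑ (allFin N) (isFree ∘′ B)

  claim-decreases : ∀ (B : Board N) {i} c → B i ≡ free → c ≢ free → freeCount (B [ i ≔ c ]) < freeCount B
  claim-decreases B {i} c i-free c≢free = ∑-mono-< (allFin N) pointwise (∈-allFin i) at-i
    where
    pointwise : ∀ j → isFree ((B [ i ≔ c ]) j) ≤ isFree (B j)
    pointwise j with i Fin.≟ j
    ... | yes refl rewrite isFree-claimed c≢free = z≤n
    ... | no  _    = ℕ.≤-refl

    at-i : isFree ((B [ i ≔ c ]) i) < isFree (B i)
    at-i rewrite update-same B i c | isFree-claimed c≢free | i-free = s≤s z≤n

  finished-or-free : ∀ (B : Board N) → Finished B ⊎ ∃ λ i → B i ≡ free
  finished-or-free B with Fin.any? (λ i → free? (B i))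
  ... | yes some-free = inj₂ some-free
  ... | no  none-free = inj₁ λ i i-free → none-free (i , i-free)

  claim-maker-keeps : ∀ m → B y ≡ maker → (B [ m ≔ maker ]) y ≡ maker
  claim-maker-keeps {y = y} m y-maker with m Fin.≟ y
  ... | yes refl = refl
  ... | no  _    = y-maker

  Held : Board N → Fin N → Fin N → Set
  Held B x y = B x ≡ breaker → B y ≡ maker

  held-claim-maker : ∀ m → Held B x y → Held (B [ m ≔ maker ]) x y
  held-claim-maker {x = x} {y} m held x-breaker with m Fin.≟ x | m Fin.≟ y
  ... | yes refl | _        = contradiction x-breaker λ ()
  ... | no _     | yes refl = refl
  ... | no _     | no  _    = held x-breaker

  held-claim-breaker : B b ≡ free → b ≢ x → Held B x y → Held (B [ b ≔ breaker ]) x y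
  held-claim-breaker {B} {b} {x} {y} b-free b≢x held x-breaker = trans (update-other B breaker b≢y) y-maker
    where
    y-maker : B y ≡ maker
    y-maker = held (trans (sym (update-other B breaker b≢x)) x-breaker)

    b≢y : b ≢ y
    b≢y refl = contradiction (trans (sym b-free) y-maker) λ ()

module PairingStrategy {N : ℕ} {p : Fin N → Maybe (Fin N)} (p-pairing : IsPairing p) where

  PartnersHeld : Board N → Set
  PartnersHeld B = ∀ x y → p x ≡ just y → Held B x y

  HeldExcept : Fin N → Board N → Set
  HeldExcept b B = ∀ x y → p x ≡ just y → b ≢ x → Held B x y

  MakerInvariant : Maybe (Fin N) → Board N → Set
  MakerInvariant nothing  B = PartnersHeld B
  MakerInvariant (just b) B = HeldExcept b B × B b ≡ breaker

  after-breaker : ∀ {B b} → PartnersHeld B → B b ≡ free → MakerInvariant (just b) (B [ b ≔ breaker ])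
  after-breaker {B} {b} held b-free =
    (λ x y pxy b≢x → held-claim-breaker b-free b≢x (held x y pxy)) , update-same B b breaker

  partner-of-last-move : ∀ {B b j} → MakerInvariant (just b) B → p b ≡ just j → B j ≢ free → B j ≡ maker
  partner-of-last-move {B} {b} {j} (held , b-breaker) pbj j-claimed with B j in j-cell
  ... | free    = contradiction refl j-claimed
  ... | maker   = refl
  ... | breaker = contradiction (trans (sym b-breaker) b-maker) λ ()
    where
    b-maker : B b ≡ maker
    b-maker = held j b (proj₁ (p-pairing b j pbj)) (proj₂ (p-pairing b j pbj)) j-cell

  restore : ∀ {B b} → HeldExcept b B → (∀ j → p b ≡ just j → B j ≡ maker) → PartnersHeld B
  restore {b = b} held partner-maker x y pxy with b Fin.≟ x
  ... | yes refl = λ _ → partner-maker y pxy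
  ... | no  b≢x  = held x y pxy b≢x

  sole-partner : ∀ {B : Board N} {b j} → p b ≡ just j → B j ≡ maker → ∀ j′ → p b ≡ just j′ → B j′ ≡ maker
  sole-partner {B} pbj j-maker j′ pbj′ = subst (λ k → B k ≡ maker) (just-injective (trans (sym pbj) pbj′)) j-maker

  held-after-reply : ∀ {B b} m → HeldExcept b B → (∀ j → p b ≡ just j → (B [ m ≔ maker ]) j ≡ maker) →
                     PartnersHeld (B [ m ≔ maker ])
  held-after-reply m held = restore λ x y pxy b≢x → held-claim-maker m (held x y pxy b≢x)

  finished-held : ∀ last {B} → MakerInvariant last B → Finished B → PartnersHeld B
  finished-held nothing  held             done = held
  finished-held (just b) inv@(held , _) done = restore held λ j pbj → partner-of-last-move inv pbj (done j)

  respects-unpaired : ∀ {B b i} → p b ≡ nothing → Respects p B (just b) i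
  respects-unpaired pb rewrite pb = tt

  respects-paired : ∀ {B b i j} → p b ≡ just j → (B j ≡ free → i ≡ j) → Respects p B (just b) i
  respects-paired pb forced rewrite pb = forced

  record Reply (last : Maybe (Fin N)) (B : Board N) : Set where
    field
      move          : Fin N
      move-free     : B move ≡ free
      move-respects : Respects p B last move
      held          : PartnersHeld (B [ move ≔ maker ])

  reply : ∀ last {B} → MakerInvariant last B → ∀ i → B i ≡ free → Reply last B
  reply nothing held i i-free = record
    { move = i ; move-free = i-free ; move-respects = tt
    ; held = λ x y pxy → held-claim-maker i (held x y pxy) }
  reply (just b) {B} inv@(held , _) i i-free with p b in pb
  ... | nothing = record
    { move = i ; move-free = i-free ; move-respects = respects-unpaired pb
    ; held = held-after-reply i held λ j pbj → contradiction (trans (sym pb) pbj) λ () }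
  ... | just j with free? (B j)
  ...   | yes j-free = record
    { move = j ; move-free = j-free ; move-respects = respects-paired pb λ _ → refl
    ; held = held-after-reply j held (sole-partner pb (update-same B j maker)) }
  ...   | no j-claimed = record
    { move = i ; move-free = i-free ; move-respects = respects-paired pb λ j-free → contradiction j-free j-claimed
    ; held = held-after-reply i held (sole-partner pb (claim-maker-keeps i (partner-of-last-move inv pb j-claimed))) }

  module _ {F : List (List (Fin N))} {s t : ℕ} (final : ∀ B → Finished B → PartnersHeld B → t ≤ score F s B) where

    mutual
      makerPlay : ∀ last B → Acc _<_ (freeCount B) → MakerInvariant last B → MakerTurn p F s t B last
      makerPlay last B (acc rs) inv with finished-or-free B
      ... | inj₁ done         = m-done done (final B done (finished-held last inv done))
      ... | inj₂ (i , i-free) =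
        m-move move move-free move-respects (breakerPlay _ (rs (claim-decreases B maker move-free λ ())) held)
        where open Reply (reply last inv i i-free)

      breakerPlay : ∀ B → Acc _<_ (freeCount B) → PartnersHeld B → BreakerTurn p F s t B
      breakerPlay B (acc rs) held with finished-or-free B
      ... | inj₁ done      = b-done done (final B done held)
      ... | inj₂ some-free = b-all some-free λ b b-free →
        makerPlay (just b) _ (rs (claim-decreases B breaker b-free λ ())) (after-breaker held b-free)

    pairing-strategy : MakerTurn p F s t emptyBoard nothing
    pairing-strategy = makerPlay nothing emptyBoard (<-wellFounded _) λ _ _ _ ()

-- The lattice pairing

⊕-identityʳ : ∀ q → q ⊕ (ℤ.+ 0 , ℤ.+ 0) ≡ q
⊕-identityʳ (a , b) = cong₂ _,_ (ℤ.+-identityʳ a) (ℤ.+-identityʳ b)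

⊕-assoc : ∀ q u v → (q ⊕ u) ⊕ v ≡ q ⊕ (u ⊕ v)
⊕-assoc (a , b) (c , d) (e , f) = cong₂ _,_ (ℤ.+-assoc a c e) (ℤ.+-assoc b d f)

-e₁ : Point
-e₁ = (-[1+ 0 ] , ℤ.+ 0)

evenℕ : ℕ → Bool
evenℕ zero    = true
evenℕ (suc n) = not (evenℕ n)

even : ℤ → Bool
even (ℤ.+ n)  = evenℕ n
even -[1+ n ] = not (evenℕ n)

even-+1 : ∀ a → even (a ℤ.+ ℤ.+ 1) ≡ not (even a)
even-+1 (ℤ.+ n)        = evenℕ-+1 n
  where
  evenℕ-+1 : ∀ n → evenℕ (n + 1) ≡ not (evenℕ n)
  evenℕ-+1 zero    = refl
  evenℕ-+1 (suc n) = cong not (evenℕ-+1 n)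
even-+1 -[1+ zero ]    = refl
even-+1 -[1+ suc n ]   = sym (not-involutive (not (evenℕ n)))

even-−1 : ∀ a → even (a ℤ.+ -[1+ 0 ]) ≡ not (even a)
even-−1 a = begin
  even (a ℤ.+ -[1+ 0 ])                      ≡⟨ sym (not-involutive _) ⟩
  not (not (even (a ℤ.+ -[1+ 0 ])))          ≡⟨ cong not (sym (even-+1 (a ℤ.+ -[1+ 0 ]))) ⟩
  not (even ((a ℤ.+ -[1+ 0 ]) ℤ.+ ℤ.+ 1))    ≡⟨ cong (not ∘ even) (trans (ℤ.+-assoc a -[1+ 0 ] (ℤ.+ 1))
                                                                      (ℤ.+-identityʳ a)) ⟩
  not (even a)                               ∎
  where open ≡-Reasoning

evenColumn : Point → Bool
evenColumn (a , _) = even a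

parity : ∀ (q : Point) → evenColumn q ≡ true ⊎ evenColumn q ≡ false
parity q with evenColumn q
... | true  = inj₁ refl
... | false = inj₂ refl

mate-offset : Point → Point
mate-offset q = if evenColumn q then e₁ else -e₁

mate : Point → Point
mate q = q ⊕ mate-offset q

mate-offset∈nbrs : ∀ q → mate-offset q ∈ nbrs
mate-offset∈nbrs q with evenColumn q
... | true  = here refl
... | false = there (here refl)

mate-even : ∀ q → evenColumn q ≡ true → mate q ≡ q ⊕ e₁
mate-even _ even-q rewrite even-q = refl

mate-odd : ∀ q → evenColumn q ≡ false → mate q ≡ q ⊕ -e₁
mate-odd _ odd-q rewrite odd-q = refl

mate-flips-parity : ∀ q → evenColumn (mate q) ≡ not (evenColumn q)
mate-flips-parity q with parity q
... | inj₁ even-q = trans (cong evenColumn (mate-even q even-q)) (even-+1 (proj₁ q))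
... | inj₂ odd-q  = trans (cong evenColumn (mate-odd q odd-q)) (even-−1 (proj₁ q))

mate-involutive : ∀ q → mate (mate q) ≡ q
mate-involutive q with parity q
... | inj₁ even-q = begin
  mate (mate q)           ≡⟨ cong mate (mate-even q even-q) ⟩
  mate (q ⊕ e₁)           ≡⟨ mate-odd (q ⊕ e₁) (trans (even-+1 (proj₁ q)) (cong not even-q)) ⟩
  (q ⊕ e₁) ⊕ -e₁          ≡⟨ ⊕-assoc q e₁ -e₁ ⟩
  q ⊕ (ℤ.+ 0 , ℤ.+ 0)     ≡⟨ ⊕-identityʳ q ⟩
  q                       ∎
  where open ≡-Reasoning
... | inj₂ odd-q = begin
  mate (mate q)           ≡⟨ cong mate (mate-odd q odd-q) ⟩
  mate (q ⊕ -e₁)          ≡⟨ mate-even (q ⊕ -e₁) (trans (even-−1 (proj₁ q)) (cong not odd-q)) ⟩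
  (q ⊕ -e₁) ⊕ e₁          ≡⟨ ⊕-assoc q -e₁ e₁ ⟩
  q ⊕ (ℤ.+ 0 , ℤ.+ 0)     ≡⟨ ⊕-identityʳ q ⟩
  q                       ∎
  where open ≡-Reasoning

mate-≢ : ∀ q → mate q ≢ q
mate-≢ q mate-q≡q = not-¬ (cong evenColumn mate-q≡q) (mate-flips-parity q)

module _ {q : Point} where

  indexOf-lookup : ∀ V {j} → indexOf q V ≡ just j → lookup V j ≡ q
  indexOf-lookup (r ∷ V) q↦j  with q ≟ᴾ r
  indexOf-lookup (r ∷ V) refl | yes refl = refl
  indexOf-lookup (r ∷ V) q↦j  | no _ with indexOf q V in q↦j′
  indexOf-lookup (r ∷ V) refl | no _ | just j′ = indexOf-lookup V q↦j′

  indexOf⇒∈ : ∀ V {j} → indexOf q V ≡ just j → q ∈ V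
  indexOf⇒∈ V q↦j = subst (_∈ V) (indexOf-lookup V q↦j) (∈-lookup _)

  memb⇒indexOf : ∀ V → memb q V ≡ true → ∃ λ j → indexOf q V ≡ just j
  memb⇒indexOf V q∈V with indexOf q V
  ... | just j = j , refl

indexOf-lookup-self : ∀ {V} → Unique V → ∀ j → indexOf (lookup V j) V ≡ just j
indexOf-lookup-self {r ∷ V} (r∉V ∷ V-unique) Fin.zero with r ≟ᴾ r
... | yes _   = refl
... | no  r≢r = contradiction refl r≢r
indexOf-lookup-self {r ∷ V} (r∉V ∷ V-unique) (Fin.suc j) with lookup V j ≟ᴾ r
... | yes rj≡r = contradiction (sym rj≡r) (All.lookup r∉V (indexOf⇒∈ V (indexOf-lookup-self V-unique j)))
... | no  _ rewrite indexOf-lookup-self V-unique j = refl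

all-∈ : ∀ {f : A → Bool} {x xs} → all f xs ≡ true → x ∈ xs → f x ≡ true
all-∈ {xs = y ∷ ys} all-f (here refl)  = ∧-conicalˡ _ _ all-f
all-∈ {xs = y ∷ ys} all-f (there x∈ys) = all-∈ (∧-conicalʳ _ _ all-f) x∈ys

deep-pred : ∀ V d q → deep V (suc d) q ≡ true → deep V d q ≡ true
deep-pred V d q deep-q = ∧-conicalˡ _ _ deep-q

deep-step : ∀ V d q {u} → deep V (suc d) q ≡ true → u ∈ nbrs → deep V d (q ⊕ u) ≡ true
deep-step V d q deep-q = all-∈ {f = λ u → deep V d (q ⊕ u)} (∧-conicalʳ (deep V d q) _ deep-q)

-- Counting lost triangles

at-most-one : ∀ {a b} → a ≤ 1 → b ≤ 1 → (0 < a → 0 < b → ⊥) → a + b ≤ 1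
at-most-one {zero}                _        b≤1 _        = b≤1
at-most-one {suc zero} {zero}     _        _   _        = s≤s z≤n
at-most-one {suc zero} {suc _}    _        _   not-both = contradiction (s≤s z≤n) (not-both (s≤s z≤n))
at-most-one {suc (suc _)}         (s≤s ()) _   _

lost-bound-arithmetic : ∀ {L S n c d} → L ≤ S + c → 2 * (L + S) ≤ n + 2 * (c + d) → d ≤ c → 4 * L ≤ n + 6 * c
lost-bound-arithmetic {L} {S} {n} {c} {d} L≤S+c pairs d≤c = begin
  4 * L                    ≡⟨ double L ⟩
  2 * L + 2 * L            ≤⟨ ℕ.+-monoʳ-≤ (2 * L) (ℕ.*-monoʳ-≤ 2 L≤S+c) ⟩
  2 * L + 2 * (S + c)      ≡⟨ regroup L S c ⟩
  2 * (L + S) + 2 * c      ≤⟨ ℕ.+-monoˡ-≤ (2 * c) pairs ⟩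
  n + 2 * (c + d) + 2 * c  ≤⟨ ℕ.+-monoˡ-≤ (2 * c) (ℕ.+-monoʳ-≤ n (ℕ.*-monoʳ-≤ 2 (ℕ.+-monoʳ-≤ c d≤c))) ⟩
  n + 2 * (c + c) + 2 * c  ≡⟨ collect n c ⟩
  n + 6 * c                ∎
  where
  open ℕ.≤-Reasoning
  double : ∀ a → 4 * a ≡ 2 * a + 2 * a
  double = solve-∀
  regroup : ∀ a b c → 2 * a + 2 * (b + c) ≡ 2 * (a + b) + 2 * c
  regroup = solve-∀
  collect : ∀ a c → a + 2 * (c + c) + 2 * c ≡ a + 6 * c
  collect = solve-∀

score-bound-arithmetic : ∀ K n c → K * c ≤ n → 3 * K * n ≤ 4 * K * (n ∸ (n + c) / 4) + 4 * n
score-bound-arithmetic K n c Kc≤n = begin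
  3 * K * n          ≤⟨ ℕ.+-cancelˡ-≤ (K * n) _ _ shifted ⟩
  4 * K * t + n      ≤⟨ ℕ.+-monoʳ-≤ (4 * K * t) (ℕ.m≤n*m n 4) ⟩
  4 * K * t + 4 * n  ∎
  where
  open ℕ.≤-Reasoning
  q t : ℕ
  q = (n + c) / 4
  t = n ∸ q

  4q≤n+c : 4 * q ≤ n + c
  4q≤n+c = subst (_≤ n + c) (ℕ.*-comm q 4) (m/n*n≤m (n + c) 4)

  shifted : K * n + 3 * K * n ≤ K * n + (4 * K * t + n)
  shifted = begin
    K * n + 3 * K * n            ≡⟨ merge K n ⟩
    4 * K * n                    ≤⟨ ℕ.*-monoʳ-≤ (4 * K) (ℕ.m≤n+m∸n n q) ⟩
    4 * K * (q + t)              ≡⟨ split K q t ⟩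
    K * (4 * q) + 4 * K * t      ≤⟨ ℕ.+-monoˡ-≤ (4 * K * t) (ℕ.*-monoʳ-≤ K 4q≤n+c) ⟩
    K * (n + c) + 4 * K * t      ≡⟨ expand K n c t ⟩
    K * n + (K * c + 4 * K * t)  ≤⟨ ℕ.+-monoʳ-≤ (K * n) (ℕ.+-monoˡ-≤ (4 * K * t) Kc≤n) ⟩
    K * n + (n + 4 * K * t)      ≡⟨ cong (_+_ (K * n)) (ℕ.+-comm n (4 * K * t)) ⟩
    K * n + (4 * K * t + n)      ∎
    where
    merge : ∀ K n → K * n + 3 * K * n ≡ 4 * K * n
    merge = solve-∀
    split : ∀ K q t → 4 * K * (q + t) ≡ K * (4 * q) + 4 * K * t
    split = solve-∀
    expand : ∀ K n c t → K * (n + c) + 4 * K * t ≡ K * n + (K * c + 4 * K * t)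
    expand = solve-∀

module TriangleGame (V : List Point) (V-unique : Unique V) where

  WinSet : Set
  WinSet = List (Fin (length V))

  partner : Fin (length V) → Maybe (Fin (length V))
  partner i = indexOf (mate (lookup V i)) V

  partner-pairing : IsPairing partner
  partner-pairing i j i↦j = j↦i , i≢j
    where
    lookup-j : lookup V j ≡ mate (lookup V i)
    lookup-j = indexOf-lookup V i↦j

    j↦i : partner j ≡ just i
    j↦i = begin
      indexOf (mate (lookup V j)) V         ≡⟨ cong (λ r → indexOf (mate r) V) lookup-j ⟩
      indexOf (mate (mate (lookup V i))) V  ≡⟨ cong (λ r → indexOf r V) (mate-involutive (lookup V i)) ⟩
      indexOf (lookup V i) V                ≡⟨ indexOf-lookup-self V-unique i ⟩
      just i                                ∎
      where open ≡-Reasoning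

    i≢j : i ≢ j
    i≢j refl = mate-≢ (lookup V i) (sym lookup-j)

  trianglesAt : Point → Fin (length V) → List WinSet
  trianglesAt p i = triAt V p i e₁ e₂ ++ triAt V p i e₂-e₁ e₂

  anchoredAt : Point → List WinSet
  anchoredAt p = maybe (trianglesAt p) [] (indexOf p V)

  data AnchorView (p : Point) : List WinSet → Set where
    outside : indexOf p V ≡ nothing → AnchorView p []
    inside  : ∀ {i} → indexOf p V ≡ just i → AnchorView p (trianglesAt p i)

  anchorView : ∀ p → AnchorView p (anchoredAt p)
  anchorView p with indexOf p V in p↦
  ... | just i  = inside p↦
  ... | nothing = outside p↦

  module _ (p : Point) (i : Fin (length V)) (u v : Point) where

    triAt-∈ : ∀ {S} → S ∈ triAt V p i u v →
              ∃₂ λ j k → S ≡ i ∷ j ∷ k ∷ [] × indexOf (p ⊕ u) V ≡ just j × indexOf (p ⊕ v) V ≡ just k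
    triAt-∈ S∈ with indexOf (p ⊕ u) V | indexOf (p ⊕ v) V
    triAt-∈ (here refl) | just j | just k = j , k , refl , refl , refl

    triAt-length≤1 : length (triAt V p i u v) ≤ 1
    triAt-length≤1 with indexOf (p ⊕ u) V | indexOf (p ⊕ v) V
    ... | just _  | just _  = s≤s z≤n
    ... | just _  | nothing = z≤n
    ... | nothing | _       = z≤n

    triAt-length-complete : (∃ λ j → indexOf (p ⊕ u) V ≡ just j) → (∃ λ k → indexOf (p ⊕ v) V ≡ just k) →
                            length (triAt V p i u v) ≡ 1
    triAt-length-complete (_ , pu↦) (_ , pv↦) rewrite pu↦ | pv↦ = refl

  trianglesAt-∈ : ∀ {p i S} → S ∈ trianglesAt p i → ∃ λ rest → S ≡ i ∷ rest
  trianglesAt-∈ {p} {i} S∈ with ∈-++⁻ (triAt V p i e₁ e₂) S∈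
  ... | inj₁ S∈up with triAt-∈ p i e₁ e₂ S∈up
  ...   | _ , _ , refl , _ = _ , refl
  trianglesAt-∈ {p} {i} S∈ | inj₂ S∈down with triAt-∈ p i e₂-e₁ e₂ S∈down
  ...   | _ , _ , refl , _ = _ , refl

  anchoredAt-∈ : ∀ {p S} → S ∈ anchoredAt p → ∃ λ i → indexOf p V ≡ just i × ∃ λ rest → S ≡ i ∷ rest
  anchoredAt-∈ {p} S∈ with anchoredAt p | anchorView p
  ... | _ | inside p↦i = _ , p↦i , trianglesAt-∈ {p} S∈

  anchoredAt-lookup : ∀ i → anchoredAt (lookup V i) ≡ trianglesAt (lookup V i) i
  anchoredAt-lookup i = cong (maybe (trianglesAt (lookup V i)) []) (indexOf-lookup-self V-unique i)

  anchoredAt-support : ∀ {P : WinSet → Set} (P? : Decidable P) {q} → count P? (anchoredAt q) ≢ 0 → q ∈ V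
  anchoredAt-support P? {q} count≢0 with anchoredAt q | anchorView q
  ... | _ | outside _   = contradiction refl count≢0
  ... | _ | inside q↦i = indexOf⇒∈ V q↦i

  ∑-anchoredAt : (k : List WinSet → ℕ) → k [] ≡ 0 → (∀ xs ys → k (xs ++ ys) ≡ k xs + k ys) →
                 k (triangles V) ≡ ∑ V (k ∘ anchoredAt)
  ∑-anchoredAt k k[] k++ = begin
    k (triangles V)                                   ≡⟨ ∑-concatMap k k[] k++ _ indices ⟩
    ∑ indices (λ i → k (trianglesAt (lookup V i) i))  ≡⟨ ∑-cong indices (cong k ∘ sym ∘ anchoredAt-lookup) ⟩
    ∑ indices (k ∘ anchoredAt ∘ lookup V)             ≡⟨ sym (∑-map (lookup V) indices (k ∘ anchoredAt)) ⟩
    ∑ (map (lookup V) indices) (k ∘ anchoredAt)       ≡⟨ cong (λ xs → ∑ xs (k ∘ anchoredAt)) lookup-allFin ⟩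
    ∑ V (k ∘ anchoredAt)                              ∎
    where
    open ≡-Reasoning
    indices : List (Fin (length V))
    indices = allFin (length V)

    lookup-allFin : map (lookup V) indices ≡ V
    lookup-allFin = trans (List.map-tabulate id (lookup V)) (List.tabulate-lookup V)

  NearBoundary : WinSet → Set
  NearBoundary S = ¬ (all (λ i → deep V 3 (lookup V i)) S ≡ true)

  nearBoundary? : Decidable NearBoundary
  nearBoundary? S = ¬? (all (λ i → deep V 3 (lookup V i)) S Bool.≟ true)

  anchoredCount nearBoundaryAt : Point → ℕ
  anchoredCount p  = length (anchoredAt p)
  nearBoundaryAt p = count nearBoundary? (anchoredAt p)

  anchored-near-boundary : ∀ {p S} → deep V 3 p ≢ true → S ∈ anchoredAt p → NearBoundary S
  anchored-near-boundary {p} shallow S∈ all-deep with anchoredAt-∈ S∈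
  ... | i , p↦i , rest , refl =
    shallow (subst (λ q → deep V 3 q ≡ true) (indexOf-lookup V p↦i) (∧-conicalˡ _ _ all-deep))

  nearBoundaryAt-shallow : ∀ {p} → deep V 3 p ≢ true → nearBoundaryAt p ≡ anchoredCount p
  nearBoundaryAt-shallow shallow =
    cong length (List.filter-all nearBoundary? (All.tabulate (anchored-near-boundary shallow)))

  memb⇒∈ : ∀ {q} → memb q V ≡ true → q ∈ V
  memb⇒∈ q∈V = indexOf⇒∈ V (proj₂ (memb⇒indexOf V q∈V))

  anchoredCount-interior : ∀ {p} → deep V 1 p ≡ true → anchoredCount p ≡ 2
  anchoredCount-interior {p} deep-p with anchoredAt p | anchorView p
  ... | _ | outside p↦nothing = contradiction (trans (sym (proj₂ p↦j)) p↦nothing) λ ()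
    where
    p↦j : ∃ λ j → indexOf p V ≡ just j
    p↦j = memb⇒indexOf V (deep-pred V 0 p deep-p)
  ... | _ | inside {i} p↦i =
    trans (List.length-++ (triAt V p i e₁ e₂))
          (cong₂ _+_ (triAt-length-complete p i e₁ e₂ (index (here refl)) (index e₂∈nbrs))
                     (triAt-length-complete p i e₂-e₁ e₂ (index e₂-e₁∈nbrs) (index e₂∈nbrs)))
    where
    index : ∀ {u} → u ∈ nbrs → ∃ λ j → indexOf (p ⊕ u) V ≡ just j
    index u∈nbrs = memb⇒indexOf V (deep-step V 0 p deep-p u∈nbrs)

    e₂∈nbrs : e₂ ∈ nbrs
    e₂∈nbrs = there (there (here refl))

    e₂-e₁∈nbrs : e₂-e₁ ∈ nbrs
    e₂-e₁∈nbrs = there (there (there (there (there (here refl)))))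

  open PairingStrategy partner-pairing using (PartnersHeld; pairing-strategy)

  module _ (B : Board (length V)) where

    Lost : WinSet → Set
    Lost S = ¬ (1 ≤ makerCount B S)

    lost? : Decidable Lost
    lost? = ∁? (λ S → 1 ≤? makerCount B S)

    BreakerAt : Point → Set
    BreakerAt q = ∃ λ j → indexOf q V ≡ just j × B j ≢ maker

    maker-vertex-scores : ∀ {S x} → x ∈ S → B x ≡ maker → 1 ≤ makerCount B S
    maker-vertex-scores (here refl) x-maker rewrite x-maker = s≤s z≤n
    maker-vertex-scores {y ∷ S} (there x∈S) x-maker with isMaker (B y)
    ... | true  = s≤s z≤n
    ... | false = maker-vertex-scores x∈S x-maker

    lost-triAt : ∀ p i u v → indexOf p V ≡ just i → 0 < count lost? (triAt V p i u v) →
                 BreakerAt p × BreakerAt (p ⊕ u) × BreakerAt (p ⊕ v)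
    lost-triAt p i u v p↦i some-lost with count>0⇒∃ lost? (triAt V p i u v) some-lost
    ... | S , S∈ , S-lost with triAt-∈ p i u v S∈
    ...   | j , k , refl , pu↦j , pv↦k =
      (i , p↦i , not-maker (here refl)) , (j , pu↦j , not-maker (there (here refl))) ,
      (k , pv↦k , not-maker (there (there (here refl))))
      where
      not-maker : ∀ {x} → x ∈ i ∷ j ∷ k ∷ [] → B x ≢ maker
      not-maker x∈S = S-lost ∘ maker-vertex-scores x∈S

    lostAt : Point → ℕ
    lostAt p = count lost? (anchoredAt p)

    lostAt-anchor : ∀ p → 0 < lostAt p → BreakerAt p
    lostAt-anchor p some-lost with count>0⇒∃ lost? (anchoredAt p) some-lost
    ... | S , S∈ , S-lost with anchoredAt-∈ S∈
    ...   | i , p↦i , _ , refl = i , p↦i , S-lost ∘ maker-vertex-scores (here refl)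

    lostAt≤nearBoundaryAt : ∀ {p} → deep V 3 p ≢ true → lostAt p ≤ nearBoundaryAt p
    lostAt≤nearBoundaryAt {p} shallow =
      subst (lostAt p ≤_) (sym (nearBoundaryAt-shallow shallow)) (List.length-filter lost? (anchoredAt p))

    module _ (B-finished : Finished B) (held : PartnersHeld B) where

      mates-not-both-Breaker : ∀ q → BreakerAt q → BreakerAt (mate q) → ⊥
      mates-not-both-Breaker q (j , q↦j , j-not-maker) (j′ , mate-q↦j′ , j′-not-maker) =
        j′-not-maker (held j j′ j↦j′ (breaker-if-claimed (B-finished j) j-not-maker))
        where
        j↦j′ : partner j ≡ just j′
        j↦j′ = trans (cong (λ r → indexOf (mate r) V) (indexOf-lookup V q↦j)) mate-q↦j′

      -- A lost up-triangle at p contains the pair of p when the column of p is even;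
      -- a lost down-triangle at p contains the pair of p ⊕ e₂-e₁ when it is odd.
      not-both-orientations : ∀ p → BreakerAt p → BreakerAt (p ⊕ e₁) → BreakerAt (p ⊕ e₂-e₁) → BreakerAt (p ⊕ e₂) → ⊥
      not-both-orientations p p-B right-B upper-left-B upper-B with parity p
      ... | inj₁ even-p = mates-not-both-Breaker p p-B (subst BreakerAt (sym (mate-even p even-p)) right-B)
      ... | inj₂ odd-p  = mates-not-both-Breaker (p ⊕ e₂-e₁) upper-left-B (subst BreakerAt mate-upper-left upper-B)
        where
        mate-upper-left : p ⊕ e₂ ≡ mate (p ⊕ e₂-e₁)
        mate-upper-left = trans (sym (⊕-assoc p e₂-e₁ e₁))
                                (sym (mate-even (p ⊕ e₂-e₁) (trans (even-−1 (proj₁ p)) (cong not odd-p))))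

      lostAt≤1 : ∀ p → lostAt p ≤ 1
      lostAt≤1 p with anchoredAt p | anchorView p
      ... | _ | outside _ = z≤n
      ... | _ | inside {i} p↦i =
        ℕ.≤-trans (ℕ.≤-reflexive (count-++ lost? (triAt V p i e₁ e₂) (triAt V p i e₂-e₁ e₂)))
          (at-most-one (lost≤1 e₁ e₂) (lost≤1 e₂-e₁ e₂) λ up-lost down-lost →
            let p-B , right-B , upper-B = lost-triAt p i e₁ e₂ p↦i up-lost
                _ , upper-left-B , _    = lost-triAt p i e₂-e₁ e₂ p↦i down-lost
            in  not-both-orientations p p-B right-B upper-left-B upper-B)
        where
        lost≤1 : ∀ u v → count lost? (triAt V p i u v) ≤ 1
        lost≤1 u v = ℕ.≤-trans (List.length-filter lost? (triAt V p i u v)) (triAt-length≤1 p i u v)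

      lostAt-mate : ∀ p → lostAt p + lostAt (mate p) ≤ 1
      lostAt-mate p = at-most-one (lostAt≤1 p) (lostAt≤1 (mate p)) λ p-lost mate-lost →
        mates-not-both-Breaker p (lostAt-anchor p p-lost) (lostAt-anchor (mate p) mate-lost)

      pair-bound-interior : ∀ p → deep V 1 p ≡ true →
                            2 * (lostAt p + lostAt (mate p)) ≤
                            anchoredCount p + 2 * (nearBoundaryAt p + nearBoundaryAt (mate p))
      pair-bound-interior p interior = begin
        2 * (lostAt p + lostAt (mate p))  ≤⟨ ℕ.*-monoʳ-≤ 2 (lostAt-mate p) ⟩
        2                                 ≡⟨ sym (anchoredCount-interior interior) ⟩
        anchoredCount p                   ≤⟨ ℕ.m≤m+n _ _ ⟩
        anchoredCount p + 2 * (nearBoundaryAt p + nearBoundaryAt (mate p)) ∎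
        where open ℕ.≤-Reasoning

      pair-bound-boundary : ∀ p → deep V 1 p ≢ true →
                            2 * (lostAt p + lostAt (mate p)) ≤
                            anchoredCount p + 2 * (nearBoundaryAt p + nearBoundaryAt (mate p))
      pair-bound-boundary p boundary = begin
        2 * (lostAt p + lostAt (mate p))
          ≤⟨ ℕ.*-monoʳ-≤ 2 (ℕ.+-mono-≤ (lostAt≤nearBoundaryAt shallow) (lostAt≤nearBoundaryAt mate-shallow)) ⟩
        2 * (nearBoundaryAt p + nearBoundaryAt (mate p))
          ≤⟨ ℕ.m≤n+m _ (anchoredCount p) ⟩
        anchoredCount p + 2 * (nearBoundaryAt p + nearBoundaryAt (mate p)) ∎
        where
        open ℕ.≤-Reasoning

        shallow : deep V 3 p ≢ true
        shallow = boundary ∘ deep-pred V 1 p ∘ deep-pred V 2 p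

        mate-shallow : deep V 3 (mate p) ≢ true
        mate-shallow deep-mate = boundary (deep-pred V 1 p (subst (λ q → deep V 2 q ≡ true) (mate-involutive p)
          (deep-step V 2 (mate p) deep-mate (mate-offset∈nbrs (mate p)))))

      ∑-pair-bound : 2 * (∑ V lostAt + ∑ V (lostAt ∘ mate)) ≤
                     ∑ V anchoredCount + 2 * (∑ V nearBoundaryAt + ∑ V (nearBoundaryAt ∘ mate))
      ∑-pair-bound = begin
        2 * (∑ V lostAt + ∑ V (lostAt ∘ mate))
          ≡⟨ cong (2 *_) (sym (∑-+ V lostAt (lostAt ∘ mate))) ⟩
        2 * ∑ V (λ p → lostAt p + lostAt (mate p))
          ≡⟨ sym (∑-* V 2 _) ⟩
        ∑ V (λ p → 2 * (lostAt p + lostAt (mate p)))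
          ≤⟨ ∑-mono V (λ {p} _ → [ pair-bound-interior p , pair-bound-boundary p ]′
                                       (toSum (deep V 1 p Bool.≟ true))) ⟩
        ∑ V (λ p → anchoredCount p + 2 * (nearBoundaryAt p + nearBoundaryAt (mate p)))
          ≡⟨ ∑-+ V anchoredCount _ ⟩
        ∑ V anchoredCount + ∑ V (λ p → 2 * (nearBoundaryAt p + nearBoundaryAt (mate p)))
          ≡⟨ cong (_+_ (∑ V anchoredCount)) (trans (∑-* V 2 _)
                                                    (cong (2 *_) (∑-+ V nearBoundaryAt (nearBoundaryAt ∘ mate)))) ⟩
        ∑ V anchoredCount + 2 * (∑ V nearBoundaryAt + ∑ V (nearBoundaryAt ∘ mate)) ∎
        where open ℕ.≤-Reasoning

      lost-count-bound : 4 * count lost? (triangles V) ≤ length (triangles V) + 6 * count nearBoundary? (triangles V)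
      lost-count-bound = subst₂ (λ L b → 4 * L ≤ b)
        (sym (∑-anchoredAt (count lost?) refl (count-++ lost?)))
        (sym (cong₂ (λ n c → n + 6 * c) (∑-anchoredAt length refl (λ xs ys → List.length-++ xs))
                                         (∑-anchoredAt (count nearBoundary?) refl (count-++ nearBoundary?))))
        (lost-bound-arithmetic {n = ∑ V anchoredCount} lost≤ ∑-pair-bound mate-boundary≤)
        where
        lost≤ : ∑ V lostAt ≤ ∑ V (lostAt ∘ mate) + ∑ V nearBoundaryAt
        lost≤ = ∑-≤-∑-∘-involution _≟ᴾ_ mate-involutive lostAt nearBoundaryAt V-unique λ {p} _ mate∉V →
          lostAt≤nearBoundaryAt λ deep-p →
            mate∉V (memb⇒∈ (deep-step V 0 p (deep-pred V 1 p (deep-pred V 2 p deep-p)) (mate-offset∈nbrs p)))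

        mate-boundary≤ : ∑ V (nearBoundaryAt ∘ mate) ≤ ∑ V nearBoundaryAt
        mate-boundary≤ = ∑-∘-involution-≤ _≟ᴾ_ mate-involutive nearBoundaryAt V-unique (anchoredAt-support nearBoundary?)

  private
    n NB : ℕ
    n  = length (triangles V)
    NB = count nearBoundary? (triangles V)

  triangle-pairing-guarantee : PairingGuarantee (length V) (triangles V) 1 (n ∸ (n + 6 * NB) / 4)
  triangle-pairing-guarantee = partner , partner-pairing , pairing-strategy final
    where
    final : ∀ B → Finished B → PartnersHeld B → n ∸ (n + 6 * NB) / 4 ≤ score (triangles V) 1 B
    final B done held = begin
      n ∸ (n + 6 * NB) / 4             ≤⟨ ℕ.∸-monoʳ-≤ n L≤q ⟩
      n ∸ L                            ≡⟨ cong (_∸ L) (sym score+L) ⟩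
      score (triangles V) 1 B + L ∸ L  ≡⟨ ℕ.m+n∸n≡m _ L ⟩
      score (triangles V) 1 B          ∎
      where
      open ℕ.≤-Reasoning
      L : ℕ
      L = count (lost? B) (triangles V)

      score+L : score (triangles V) 1 B + L ≡ n
      score+L = count-+-count-∁ (λ S → 1 ≤? makerCount B S) (triangles V)

      L≤q : L ≤ (n + 6 * NB) / 4
      L≤q = subst (_≤ (n + 6 * NB) / 4) (m*n/n≡m L 4)
              (/-monoˡ-≤ 4 (subst (_≤ n + 6 * NB) (ℕ.*-comm 4 L) (lost-count-bound B done held)))

theorem6 : (G : ℕ → Portion) →
    (∀ N → Σ ℕ λ M → ∀ m → M ≤ m → N ≤ nWin (G m)) →
    (∀ d k → Σ ℕ λ M → ∀ m → M ≤ m → suc k * nearBoundary d (G m) ≤ nWin (G m)) →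
    ∀ k → Σ ℕ λ M → ∀ m → M ≤ m → Σ ℕ λ t →
    (3 * suc k * nWin (G m) ≤ 4 * suc k * t + 4 * nWin (G m)) ×
    PairingGuarantee (length (pts (G m))) (winSets (G m)) 1 t
theorem6 G _ boundary-sparse k = M , λ m M≤m →
  t m , score-bound-arithmetic (suc k) (nWin (G m)) (6 * nearBoundary 3 (G m)) (sparse m M≤m) ,
  TriangleGame.triangle-pairing-guarantee (pts (G m)) (uniq (G m))
  where
  M : ℕ
  M = proj₁ (boundary-sparse 3 (5 + 6 * k))

  t : ℕ → ℕ
  t m = nWin (G m) ∸ (nWin (G m) + 6 * nearBoundary 3 (G m)) / 4

  sparse : ∀ m → M ≤ m → suc k * (6 * nearBoundary 3 (G m)) ≤ nWin (G m)
  sparse m M≤m = subst (_≤ nWin (G m)) (regroup k (nearBoundary 3 (G m))) (proj₂ (boundary-sparse 3 (5 + 6 * k)) m M≤m)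
    where
    regroup : ∀ k b → suc (5 + 6 * k) * b ≡ suc k * (6 * b)
    regroup = solve-∀
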